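{- Let $G,H$ be $\mathbf{e}$-free edge-labelled graphs and $\mathcal{R}\subseteq X_G\times X_H$. Let $S_1,\dots,S_{p-1},S_p,S_{p+1}$ be distinct vertices of a contraction $G'$ of $G$, $S_0=S_p\uplus S_{p+1}$, $\mathbb{S}=(S_1,\dots,S_{p-1})$, and let $T_0,T_1,\dots,T_{p-1}$ be nonempty subsets of $V_H$, $\mathbb{T}=(T_1,\dots,T_{p-1})$. Then $$\overline{\mathcal{R}}^{\mathbb{S},S_0}_{\mathbb{T},T_0}=\biguplus_{\substack{T_p\cup T_{p+1}=T_0\\(\mathbb{T},T_p,T_{p+1})\succeq_{\mathcal{R}}(\mathbb{S},S_p,S_{p+1})}}\overline{\mathcal{R}}^{\mathbb{S},S_p,S_{p+1}}_{\mathbb{T},T_p,T_{p+1}},$$ the union ranging over pairs $(T_p,T_{p+1})$ of nonempty subsets of $V_H$ with $T_p\cup T_{p+1}=T_0$.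
   Context: Edge-labelled graph: $G=(V_G,l_G,X_G)$, finite $V_G,X_G$, $l_G:V_G^2\to X_G$; $\mathbf{e}$-free if the special symbol $\mathbf{e}\notin X_G$; $G[S]=(S,l_G|_{S^2},X_G)$. $\mathcal{R}$-morphism: $(l_G(u,v),l_H(f(u),f(v)))\in\mathcal{R}$ for all $u,v$. A contraction $G'$ of $G$ relative to a partition of $V_G$ into nonempty parts has these parts as vertices and label $x$ on $(S,S')$ if $l_G$ is constantly $x$ on $S\times S'$, else $\mathbf{e}$. For $\mathbb{S}=(S_1,\dots,S_r)$ pairwise disjoint subsets of $V_G$ and $\mathbb{T}=(T_1,\dots,T_r)$ nonempty subsets of $V_H$, $\overline{\mathcal{R}}^{\mathbb{S}}_{\mathbb{T}}$ is the set of $\mathcal{R}$-morphisms $f$ from $G[S_1\uplus\dots\uplus S_r]$ to $H[T_1\cup\dots\cup T_r]$ with $f(S_i)=T_i$ for all $i$; commas denote concatenation of tuples. $\mathbb{T}\succeq_{\mathcal{R}}\mathbb{S}$ (for $S_i$ distinct vertices of $G'$): for all $i,i'$, if $l_{G'}(S_i,S_{i'})\neq\mathbf{e}$ then $(l_{G'}(S_i,S_{i'}),l_H(a,b))\in\mathcal{R}$ for all $(a,b)\in T_i\times T_{i'}$. -}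

module Defs where

open import Data.Nat using (ℕ)
open import Data.Fin using (Fin)
open import Data.Fin.Subset using (Subset; _∈_)
open import Data.Product using (Σ; ∃; _×_; _,_)
open import Data.Sum using (_⊎_)
open import Data.Vec.Functional using (Vector)
open import Relation.Binary.PropositionalEquality using (_≡_)

-- Being e-free is built in: the special
-- symbol e is never a value of type Fin nX (e is modelled as `nothing`
-- / as the absence of a constant label, see ContrLabel below).
record ELGraph : Set where
  field
    nV  : ℕ
    nX  : ℕ
    lab : Fin nV → Fin nV → Fin nX

open ELGraph public

Rel : ELGraph → ELGraph → Set₁
Rel G H = Fin (nX G) → Fin (nX H) → Set

VPred : ELGraph → Set₁
VPred G = Fin (nV G) → Set

-- A contraction G' of G: a partition of V_G into k nonempty parts, given by
-- the map sending a vertex to (the index of) its part; every part nonempty.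
record Contraction (G : ELGraph) : Set where
  field
    k     : ℕ
    part  : Fin (nV G) → Fin k
    onto  : ∀ (a : Fin k) → ∃ λ u → part u ≡ a

open Contraction public

PartOf : {G : ELGraph} (C : Contraction G) → Fin (k C) → VPred G
PartOf C a u = part C u ≡ a

-- "l_{G'}(a,b) = x" for a label x ∈ X_G (i.e. x ≠ e): l_G is constantly x
-- on (part a) × (part b).  (Parts are nonempty, so x is then unique;
-- l_{G'}(a,b) = e iff no such x exists.)
ContrLabel : {G : ELGraph} (C : Contraction G) → Fin (k C) → Fin (k C) → Fin (nX G) → Set
ContrLabel {G} C a b x =
  ∀ u v → part C u ≡ a → part C v ≡ b → lab G u v ≡ x

Succeq : {G H : ELGraph} (R : Rel G H) (C : Contraction G) {r : ℕ} →
         Vector (Subset (nV H)) r → Vector (Fin (k C)) r → Set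
Succeq {G} {H} R C T σ =
  ∀ i i' x → ContrLabel C (σ i) (σ i') x →
  ∀ a b → a ∈ T i → b ∈ T i' → R x (lab H a b)

InUnion : {G : ELGraph} {r : ℕ} → Vector (VPred G) r → VPred G
InUnion S u = ∃ λ i → S i u

ImageIs : {G H : ELGraph} → (Fin (nV G) → Fin (nV H)) → VPred G → Subset (nV H) → Set
ImageIs f S T =
  (∀ u → S u → f u ∈ T) × (∀ b → b ∈ T → ∃ λ u → S u × f u ≡ b)

-- Maps are represented by
-- total functions V_G → V_H of which only the restriction to
-- S_1 ⊎ ... ⊎ S_r matters (the predicate depends only on that restriction;
-- the codomain condition follows from the image conditions).
MorBar : {G H : ELGraph} (R : Rel G H) {r : ℕ} →
         Vector (VPred G) r → Vector (Subset (nV H)) r →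
         (Fin (nV G) → Fin (nV H)) → Set
MorBar {G} {H} R S T f =
  (∀ u v → InUnion {G} S u → InUnion {G} S v → R (lab G u v) (lab H (f u) (f v))) ×
  (∀ i → ImageIs {G} {H} f (S i) (T i))

-- A map f in the left-hand set lies in exactly one member of the union,
-- the one indexed by T_p = f(S_p) and T_{p+1} = f(S_{p+1}).  These images
-- are nonempty because the parts of a contraction are, their union is
-- f(S_0) = T_0, and ⪰ holds because every pair in T_i × T_{i'} is the
-- image under the R-morphism f of a pair in S_i × S_{i'}, on which l_G is
-- constantly l_{G'}(S_i, S_{i'}) whenever that label is not e.  Conversely a
-- member of the union glues back along S_0 = S_p ⊎ S_{p+1}, and the union is
-- disjoint because f determines its images.
module Submission where

open import Defs
open import Data.Nat using (ℕ)
open import Data.Fin using (Fin; zero; suc; _↑ˡ_; _↑ʳ_; splitAt; _≟_)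
open import Data.Fin.Properties using (any?)
open import Data.Fin.Subset using (Subset; Nonempty; _∪_; _∈_; _⊆_)
open import Data.Fin.Subset.Properties using (⊆-antisym; x∈p∪q⁻; x∈p∪q⁺)
open import Data.Product using (∃; _×_; _,_; proj₂)
open import Data.Sum using (_⊎_; inj₁; inj₂)
open import Data.Vec using (tabulate)
open import Data.Vec.Properties using (lookup∘tabulate; []=⇒lookup; lookup⇒[]=)
open import Data.Vec.Functional using (Vector; _++_; _∷_; [])
open import Data.Vec.Functional.Properties using (lookup-++ˡ; lookup-++ʳ)
open import Data.Vec.Functional.Relation.Binary.Pointwise using (Pointwise)
open import Data.Vec.Functional.Relation.Binary.Pointwise.Properties using (++⁺; ++⁻ˡ; ++⁻ʳ)
open import Function.Bundles using (_⇔_; mk⇔; Equivalence)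
open import Relation.Binary.PropositionalEquality using (_≡_; _≢_; refl; sym; trans; subst)
open import Relation.Nullary.Decidable using (yes; does; dec-true; _×-dec_)
open import Relation.Unary using (Pred; Decidable)

fromDecidable : ∀ {n ℓ} {P : Pred (Fin n) ℓ} → Decidable P → Subset n
fromDecidable P? = tabulate (λ b → does (P? b))

∈-fromDecidable : ∀ {n ℓ} {P : Pred (Fin n) ℓ} (P? : Decidable P) {b} → b ∈ fromDecidable P? ⇔ P b
∈-fromDecidable {P = P} P? {b} = mk⇔ from to
  where
  from : b ∈ fromDecidable P? → P b
  from b∈ with P? b | trans (sym (lookup∘tabulate _ b)) ([]=⇒lookup b∈)
  ... | yes Pb | _ = Pb
  to : P b → b ∈ fromDecidable P?
  to Pb = lookup⇒[]= b _ (trans (lookup∘tabulate _ b) (dec-true (P? b) Pb))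

module Image {G H : ELGraph} (f : Fin (nV G) → Fin (nV H)) where

  _↦_ : VPred G → Subset (nV H) → Set
  P ↦ A = ImageIs {G} {H} f P A

  ↦-⊆ : ∀ {P A B} → P ↦ A → P ↦ B → A ⊆ B
  ↦-⊆ (_ , onto-A) (into-B , _) b∈A with onto-A _ b∈A
  ... | u , Pu , refl = into-B u Pu

  ↦-unique : ∀ {P A B} → P ↦ A → P ↦ B → A ≡ B
  ↦-unique P↦A P↦B = ⊆-antisym (↦-⊆ P↦A P↦B) (↦-⊆ P↦B P↦A)

  ↦-⊎ : ∀ {P Q A B} → P ↦ A → Q ↦ B → (λ u → P u ⊎ Q u) ↦ (A ∪ B)
  ↦-⊎ {P} {Q} {A} {B} (into-A , onto-A) (into-B , onto-B) = into-A∪B , onto-A∪B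
    where
    into-A∪B : ∀ u → P u ⊎ Q u → f u ∈ A ∪ B
    into-A∪B u (inj₁ Pu) = x∈p∪q⁺ (inj₁ (into-A u Pu))
    into-A∪B u (inj₂ Qu) = x∈p∪q⁺ {p = A} (inj₂ (into-B u Qu))
    onto-A∪B : ∀ b → b ∈ A ∪ B → ∃ λ u → (P u ⊎ Q u) × f u ≡ b
    onto-A∪B b b∈ with x∈p∪q⁻ A B b∈
    ... | inj₁ b∈A = let u , Pu , fu≡b = onto-A b b∈A in u , inj₁ Pu , fu≡b
    ... | inj₂ b∈B = let u , Qu , fu≡b = onto-B b b∈B in u , inj₂ Qu , fu≡b

  ↦-nonempty : ∀ {P A} → P ↦ A → ∃ P → Nonempty A
  ↦-nonempty (into-A , _) (u , Pu) = f u , into-A u Pu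

  hits? : {P : VPred G} → Decidable P → Decidable {A = Fin (nV H)} (λ b → ∃ λ u → P u × f u ≡ b)
  hits? P? b = any? (λ u → P? u ×-dec f u ≟ b)

  image : {P : VPred G} → Decidable P → Subset (nV H)
  image P? = fromDecidable (hits? P?)

  ↦-image : ∀ {P} (P? : Decidable P) → P ↦ image P?
  ↦-image {P} P? = (λ u Pu → Equivalence.from ∈-image (u , Pu , refl))
                 , (λ b b∈ → Equivalence.to ∈-image b∈)
    where
    ∈-image : ∀ {b} → b ∈ image P? ⇔ ∃ λ u → P u × f u ≡ b
    ∈-image = ∈-fromDecidable (hits? P?)

module Union {G : ELGraph} where

  ⋃ : ∀ {r} → Vector (VPred G) r → VPred G
  ⋃ = InUnion {G}

  ⋃-++⁺ʳ : ∀ {m n n′} (Ss : Vector (VPred G) m) {Ts : Vector (VPred G) n} {Ts′ : Vector (VPred G) n′} →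
           (∀ {u} → ⋃ Ts u → ⋃ Ts′ u) → ∀ {u} → ⋃ (Ss ++ Ts) u → ⋃ (Ss ++ Ts′) u
  ⋃-++⁺ʳ {m} {n′ = n′} Ss {Ts′ = Ts′} Ts⊆Ts′ {u} (i , u∈) with splitAt m i
  ... | inj₁ j = j ↑ˡ n′ , subst (λ S → S u) (sym (lookup-++ˡ Ss Ts′ j)) u∈
  ... | inj₂ j = let j′ , u∈′ = Ts⊆Ts′ (j , u∈) in
                 m ↑ʳ j′ , subst (λ S → S u) (sym (lookup-++ʳ Ss Ts′ j′)) u∈′

  ⋃-⊎⇔ : ∀ {P Q : VPred G} {u} → ⋃ ((λ v → P v ⊎ Q v) ∷ []) u ⇔ ⋃ (P ∷ Q ∷ []) u
  ⋃-⊎⇔ = mk⇔ (λ { (zero , inj₁ Pu) → zero , Pu ; (zero , inj₂ Qu) → suc zero , Qu })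
             (λ { (zero , Pu) → zero , inj₁ Pu ; (suc zero , Qu) → zero , inj₂ Qu })

module Morphism {G H : ELGraph} (R : Rel G H) where

  IsMorphismOn : VPred G → (Fin (nV G) → Fin (nV H)) → Set
  IsMorphismOn P f = ∀ u v → P u → P v → R (lab G u v) (lab H (f u) (f v))

  IsMorphismOn-mono : ∀ {P Q : VPred G} {f} → (∀ {u} → Q u → P u) → IsMorphismOn P f → IsMorphismOn Q f
  IsMorphismOn-mono Q⊆P f-mor u v Qu Qv = f-mor u v (Q⊆P Qu) (Q⊆P Qv)

  MorBar⇒Succeq : (C : Contraction G) {r : ℕ} {σ : Vector (Fin (k C)) r} {Ss : Vector (VPred G) r}
                  {Ts : Vector (Subset (nV H)) r} {f : Fin (nV G) → Fin (nV H)} →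
                  Pointwise (λ S a → S ≡ PartOf C a) Ss σ →
                  MorBar {G} {H} R Ss Ts f → Succeq {G} {H} R C Ts σ
  MorBar⇒Succeq C {σ = σ} {Ss} Ss≡ (f-mor , f-img) i i′ x x-const a b a∈ b∈
    with proj₂ (f-img i) a a∈ | proj₂ (f-img i′) b b∈
  ... | u , u∈ , refl | v , v∈ , refl =
    subst (λ y → R y _) (x-const u v (in-part i u∈) (in-part i′ v∈)) (f-mor u v (i , u∈) (i′ , v∈))
    where
    in-part : ∀ j {w} → Ss j w → part C w ≡ σ j
    in-part j {w} w∈ = subst (λ S → S w) (Ss≡ j) w∈

module SplitPart {G H : ELGraph} (R : Rel G H) (C : Contraction G) {q : ℕ}
                 (σ : Vector (Fin (k C)) q) (sp sp1 : Fin (k C))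
                 (T : Vector (Subset (nV H)) q) (T0 : Subset (nV H)) where

  open Union {G}
  open Morphism {G} {H} R

  Map : Set
  Map = Fin (nV G) → Fin (nV H)

  S : Vector (VPred G) q
  S i = PartOf C (σ i)

  S0 : VPred G
  S0 u = PartOf C sp u ⊎ PartOf C sp1 u

  Admissible : Subset (nV H) → Subset (nV H) → Set
  Admissible Tp Tp1 = Nonempty Tp × Nonempty Tp1 × (Tp ∪ Tp1 ≡ T0) ×
                      Succeq {G} {H} R C (T ++ (Tp ∷ (Tp1 ∷ []))) (σ ++ (sp ∷ (sp1 ∷ [])))

  Piece : Subset (nV H) → Subset (nV H) → Map → Set
  Piece Tp Tp1 = MorBar {G} {H} R (S ++ (PartOf C sp ∷ (PartOf C sp1 ∷ []))) (T ++ (Tp ∷ (Tp1 ∷ [])))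

  Whole : Map → Set
  Whole = MorBar {G} {H} R (S ++ (S0 ∷ [])) (T ++ (T0 ∷ []))

  private
    ⋃-split : ∀ {u} → ⋃ (S ++ (S0 ∷ [])) u → ⋃ (S ++ (PartOf C sp ∷ (PartOf C sp1 ∷ []))) u
    ⋃-split = ⋃-++⁺ʳ S (Equivalence.to ⋃-⊎⇔)

    ⋃-merge : ∀ {u} → ⋃ (S ++ (PartOf C sp ∷ (PartOf C sp1 ∷ []))) u → ⋃ (S ++ (S0 ∷ [])) u
    ⋃-merge = ⋃-++⁺ʳ S (Equivalence.from ⋃-⊎⇔)

    part? : ∀ a → Decidable (PartOf C a)
    part? a u = part C u ≟ a

    parts : Pointwise (λ P a → P ≡ PartOf C a) (S ++ (PartOf C sp ∷ (PartOf C sp1 ∷ []))) (σ ++ (sp ∷ (sp1 ∷ [])))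
    parts = ++⁺ (λ P a → P ≡ PartOf C a) {xs = S} {ys = σ} (λ _ → refl)
                (λ { zero → refl ; (suc zero) → refl })

  split : ∀ {f} → Whole f → ∃ λ Tp → ∃ λ Tp1 → Admissible Tp Tp1 × Piece Tp Tp1 f
  split {f} (f-mor , f-img) =
    Tp , Tp1 ,
    (↦-nonempty Tp-img (onto C sp) , ↦-nonempty Tp1-img (onto C sp1) ,
     ↦-unique (↦-⊎ Tp-img Tp1-img) (++⁻ʳ _↦_ S T f-img zero) ,
     MorBar⇒Succeq C parts piece) ,
    piece
    where
    open Image {G} {H} f
    Tp Tp1 : Subset (nV H)
    Tp = image (part? sp)
    Tp1 = image (part? sp1)
    Tp-img : PartOf C sp ↦ Tp
    Tp-img = ↦-image (part? sp)
    Tp1-img : PartOf C sp1 ↦ Tp1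
    Tp1-img = ↦-image (part? sp1)
    piece : Piece Tp Tp1 f
    piece = IsMorphismOn-mono {f = f} ⋃-merge f-mor ,
            ++⁺ _↦_ (++⁻ˡ _↦_ S T f-img) (λ { zero → Tp-img ; (suc zero) → Tp1-img })

  glue : ∀ {f} → (∃ λ Tp → ∃ λ Tp1 → Admissible Tp Tp1 × Piece Tp Tp1 f) → Whole f
  glue {f} (Tp , Tp1 , (_ , _ , Tp∪Tp1≡T0 , _) , (f-mor , f-img)) =
    IsMorphismOn-mono {f = f} ⋃-split f-mor ,
    ++⁺ _↦_ (++⁻ˡ _↦_ S T f-img) (λ { zero → S0-img })
    where
    open Image {G} {H} f
    pieces-img : Pointwise _↦_ (PartOf C sp ∷ (PartOf C sp1 ∷ [])) (Tp ∷ (Tp1 ∷ []))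
    pieces-img = ++⁻ʳ _↦_ S T f-img
    S0-img : S0 ↦ T0
    S0-img = subst (S0 ↦_) Tp∪Tp1≡T0 (↦-⊎ (pieces-img zero) (pieces-img (suc zero)))

  Piece-unique : ∀ {f Tp Tp1 Tp′ Tp1′} → Piece Tp Tp1 f → Piece Tp′ Tp1′ f → (Tp ≡ Tp′) × (Tp1 ≡ Tp1′)
  Piece-unique {f} {Tp} {Tp1} {Tp′} {Tp1′} (_ , f-img) (_ , f-img′) =
    ↦-unique (pieces-img zero) (pieces-img′ zero) , ↦-unique (pieces-img (suc zero)) (pieces-img′ (suc zero))
    where
    open Image {G} {H} f
    pieces-img : Pointwise _↦_ (PartOf C sp ∷ (PartOf C sp1 ∷ [])) (Tp ∷ (Tp1 ∷ []))
    pieces-img = ++⁻ʳ _↦_ S T f-img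
    pieces-img′ : Pointwise _↦_ (PartOf C sp ∷ (PartOf C sp1 ∷ [])) (Tp′ ∷ (Tp1′ ∷ []))
    pieces-img′ = ++⁻ʳ _↦_ S T f-img′

lemma5 : (G H : ELGraph) (R : Rel G H) (C : Contraction G) (q : ℕ)
    -- 𝕊 = (S_1,…,S_{p-1}) with q = p - 1, and S_p, S_{p+1}: distinct vertices of G'
    (σ : Vector (Fin (k C)) q) (sp sp1 : Fin (k C))
    (σ-inj : ∀ i j → σ i ≡ σ j → i ≡ j)
    (σ≢sp : ∀ i → σ i ≢ sp) (σ≢sp1 : ∀ i → σ i ≢ sp1) (sp≢sp1 : sp ≢ sp1)
    -- 𝕋 = (T_1,…,T_{p-1}) and T_0: nonempty subsets of V_H
    (T : Vector (Subset (nV H)) q) (T0 : Subset (nV H))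
    (T-ne : ∀ i → Nonempty (T i)) (T0-ne : Nonempty T0) →
    let S : Vector (VPred G) q
        S i = PartOf C (σ i)
        S0 : VPred G
        S0 u = PartOf C sp u ⊎ PartOf C sp1 u
        -- admissible index pairs (T_p, T_{p+1}) of the union
        Adm : Subset (nV H) → Subset (nV H) → Set
        Adm Tp Tp1 = Nonempty Tp × Nonempty Tp1 × (Tp ∪ Tp1 ≡ T0) ×
                     Succeq {G} {H} R C (T ++ (Tp ∷ (Tp1 ∷ []))) (σ ++ (sp ∷ (sp1 ∷ [])))
        RHS : Subset (nV H) → Subset (nV H) → (Fin (nV G) → Fin (nV H)) → Set
        RHS Tp Tp1 f = MorBar {G} {H} R (S ++ (PartOf C sp ∷ (PartOf C sp1 ∷ [])))
                                (T ++ (Tp ∷ (Tp1 ∷ []))) f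
    in
    -- equality of sets
    (∀ (f : Fin (nV G) → Fin (nV H)) →
       MorBar {G} {H} R (S ++ (S0 ∷ [])) (T ++ (T0 ∷ [])) f
       ⇔ (∃ λ Tp → ∃ λ Tp1 → Adm Tp Tp1 × RHS Tp Tp1 f))
    ×
    -- the union is disjoint
    (∀ (f : Fin (nV G) → Fin (nV H)) (Tp Tp1 Tp' Tp1' : Subset (nV H)) →
       Adm Tp Tp1 → Adm Tp' Tp1' → RHS Tp Tp1 f → RHS Tp' Tp1' f →
       (Tp ≡ Tp') × (Tp1 ≡ Tp1'))
lemma5 G H R C q σ sp sp1 _ _ _ _ T T0 _ _ =
  (λ f → mk⇔ split glue) , (λ f Tp Tp1 Tp′ Tp1′ _ _ → Piece-unique)
  where open SplitPart R C σ sp sp1 T T0
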